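{- Let $b$ be a vertex of $H$, and suppose $i \in \Gamma(b)$ and $j \notin \Gamma(b)$. If the $2k$-tuple $\vec{T}=(\vec{T_1},\vec{T_2})$ is distinctly colorable and Condition 2 or Condition 3 is satisfied at $b$, but Condition 1 is not satisfied at $b$, then neither $v_i$ nor $w_i$ can be equal to either $v_j$ or $w_j$.
   Context: $H$ is a small connected graph with no leaves, with $t$ vertices labeled $1,\dots,t$ and $k$ edges; its edges are arbitrarily directed and written $\overrightarrow{a_1 a_2},\dots,\overrightarrow{a_{2k-1}a_{2k}}$ with each $a_i\in\{1,\dots,t\}$. The half-edge $h_i$ is incident to $a_i$, and for a vertex $b$ of $H$, $\Gamma(b)=\{i : a_i=b\}$ is the set of indices of half-edges incident to $b$. $G$ is a large simple graph, and $\vec{G}$ is obtained by replacing each edge $vw$ of $G$ by the two directed edges $\overrightarrow{vw}$ and $\overrightarrow{wv}$. $\vec{T}=(\vec{T_1},\vec{T_2})$ is a $2k$-tuple of (not necessarily distinct) edges of $\vec{G}$, where $\vec{T_1}=(\overrightarrow{v_1v_2},\dots,\overrightarrow{v_{2k-1}v_{2k}})$ and $\vec{T_2}=(\overrightarrow{w_1w_2},\dots,\overrightarrow{w_{2k-1}w_{2k}})$. For a vertex $b$ of $H$, the conditions are: Condition 1: the vertices $\{v_i : i\in\Gamma(b)\}$ are all the same, and the vertices $\{w_i : i\in\Gamma(b)\}$ are all the same. Condition 2: $v_i=w_i$ for all $i\in\Gamma(b)$. Condition 3: there are vertices $x,y$ of $\vec{G}$ such that for every $i\in\Gamma(b)$,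 either $v_i=x$ and $w_i=y$, or $v_i=y$ and $w_i=x$. $\vec{T}$ is called distinctly colorable if for all distinct vertices $b,c$ of $H$ and all $i\in\Gamma(b)$, $j\in\Gamma(c)$, we have $v_i\neq v_j$ and $w_i\neq w_j$ (while $v_i$ and $w_j$ need not be distinct). -}

module Defs where

open import Data.Nat using (ℕ)
open import Data.Fin using (Fin; zero; suc) renaming (_≟_ to _≟ᶠ_)
open import Data.Product using (Σ; ∃; ∃-syntax; _×_; _,_)
open import Data.Sum using (_⊎_)
open import Data.List using (List; length; filter; cartesianProduct; allFin)
open import Relation.Binary.PropositionalEquality using (_≡_; _≢_)
open import Relation.Nullary using (¬_)

-- Half-edge indices: the 2k half-edges h_1,...,h_{2k} are indexed by pairs
-- (m , ε) with m : Fin k (the edge) and ε : Fin 2 (tail = zero, head = suc zero).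
-- So h_{2m-1} ↔ (m , 0) and h_{2m} ↔ (m , 1).
HalfEdge : ℕ → Set
HalfEdge k = Fin k × Fin 2

tl hd : Fin 2
tl = zero
hd = suc zero

record SmallGraph : Set where
  field
    t : ℕ
    k : ℕ
    a : HalfEdge k → Fin t
open SmallGraph public

_∈Γ_ : {H : SmallGraph} → HalfEdge (k H) → Fin (t H) → Set
_∈Γ_ {H} i b = a H i ≡ b

allHalfEdges : (k : ℕ) → List (HalfEdge k)
allHalfEdges k = cartesianProduct (allFin k) (allFin 2)

degree : (H : SmallGraph) → Fin (t H) → ℕ
degree H b = length (filter (λ i → a H i ≟ᶠ b) (allHalfEdges (k H)))

data Path (H : SmallGraph) : Fin (t H) → Fin (t H) → Set where
  here  : ∀ {b} → Path H b b
  fwd   : ∀ {c} (m : Fin (k H)) → Path H (a H (m , hd)) c → Path H (a H (m , tl)) c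
  bwd   : ∀ {c} (m : Fin (k H)) → Path H (a H (m , tl)) c → Path H (a H (m , hd)) c

Connected : SmallGraph → Set
Connected H = ∀ b c → Path H b c

NoLeaves : SmallGraph → Set
NoLeaves H = ∀ b → degree H b ≢ 1

record SimpleGraph (n : ℕ) : Set₁ where
  field
    Adj     : Fin n → Fin n → Set
    symAdj  : ∀ {x y} → Adj x y → Adj y x
    irrefl  : ∀ {x} → ¬ Adj x x
open SimpleGraph public

IsEdgeTuple : ∀ {n} → SimpleGraph n → (k : ℕ) → (HalfEdge k → Fin n) → Set
IsEdgeTuple G k u = ∀ m → Adj G (u (m , tl)) (u (m , hd))

module _ {n : ℕ} (H : SmallGraph) (v w : HalfEdge (k H) → Fin n) where

  Condition1 : Fin (t H) → Set
  Condition1 b = ∀ i j → a H i ≡ b → a H j ≡ b → (v i ≡ v j) × (w i ≡ w j)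

  Condition2 : Fin (t H) → Set
  Condition2 b = ∀ i → a H i ≡ b → v i ≡ w i

  Condition3 : Fin (t H) → Set
  Condition3 b = ∃[ x ] ∃[ y ] (∀ i → a H i ≡ b →
                   ((v i ≡ x) × (w i ≡ y)) ⊎ ((v i ≡ y) × (w i ≡ x)))

  DistinctlyColorable : Set
  DistinctlyColorable = ∀ b c → b ≢ c → ∀ i j → a H i ≡ b → a H j ≡ c →
                          (v i ≢ v j) × (w i ≢ w j)

-- Distinct colourability already separates the half-edges at b from h_j
-- colour by colour, so only the mixed equalities v_i = w_j and w_i = v_j
-- need work.  Under Condition 2 they reduce to the pure ones via v_i = w_i.
-- Under Condition 3 every half-edge at b either agrees with h_i or carries
-- its colours in reversed order; if none were reversed, Condition 1 would
-- hold, and a reversed half-edge h_l at b has w_l = v_i and v_l = w_i, so a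
-- mixed equality would become a pure one between h_l and h_j.
module Submission where

open import Defs
open import Data.Nat using (ℕ)
open import Data.Fin using (Fin)
open import Data.Product using (_×_; _,_; proj₁; proj₂)
open import Data.Sum using (_⊎_; inj₁; inj₂)
open import Data.Empty using (⊥-elim)
open import Relation.Binary.PropositionalEquality using (_≡_; _≢_; refl; sym; trans)
open import Relation.Nullary using (¬_)

module _ (H : SmallGraph) {n : ℕ} (v w : HalfEdge (k H) → Fin n) where

  Aligned Reversed : HalfEdge (k H) → HalfEdge (k H) → Set
  Aligned  i l = (v l ≡ v i) × (w l ≡ w i)
  Reversed i l = (v l ≡ w i) × (w l ≡ v i)

  condition3⇒aligned⊎reversed : ∀ {b i l} → Condition3 H v w b →
    a H i ≡ b → a H l ≡ b → Aligned i l ⊎ Reversed i l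
  condition3⇒aligned⊎reversed {i = i} {l} (x , y , c3) ai al with c3 i ai | c3 l al
  ... | inj₁ (vi , wi) | inj₁ (vl , wl) = inj₁ (trans vl (sym vi) , trans wl (sym wi))
  ... | inj₁ (vi , wi) | inj₂ (vl , wl) = inj₂ (trans vl (sym wi) , trans wl (sym vi))
  ... | inj₂ (vi , wi) | inj₁ (vl , wl) = inj₂ (trans vl (sym wi) , trans wl (sym vi))
  ... | inj₂ (vi , wi) | inj₂ (vl , wl) = inj₁ (trans vl (sym vi) , trans wl (sym wi))

  allAligned⇒condition1 : ∀ {b} i → (∀ l → a H l ≡ b → Aligned i l) →
    Condition1 H v w b
  allAligned⇒condition1 i aligned l l′ al al′ =
    trans (proj₁ (aligned l al)) (sym (proj₁ (aligned l′ al′))) ,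
    trans (proj₂ (aligned l al)) (sym (proj₂ (aligned l′ al′)))

  ¬condition1⇒¬¬reversed : ∀ {b i} → Condition3 H v w b → ¬ Condition1 H v w b →
    a H i ≡ b → ¬ (∀ l → a H l ≡ b → ¬ Reversed i l)
  ¬condition1⇒¬¬reversed {b} {i} c3 ¬c1 ai noneReversed =
    ¬c1 (allAligned⇒condition1 i aligned)
    where
    aligned : ∀ l → a H l ≡ b → Aligned i l
    aligned l al with condition3⇒aligned⊎reversed c3 ai al
    ... | inj₁ agrees = agrees
    ... | inj₂ reversed = ⊥-elim (noneReversed l al reversed)

  distinctlyColorable⇒separated : ∀ {b i j} → DistinctlyColorable H v w →
    a H i ≡ b → a H j ≢ b → (v i ≢ v j) × (w i ≢ w j)
  distinctlyColorable⇒separated {j = j} dc ai aj≢b =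
    dc _ (a H j) (λ b≡aj → aj≢b (sym b≡aj)) _ j ai refl

  module _ {b : Fin (t H)} {i j : HalfEdge (k H)} (ai : a H i ≡ b) (aj≢b : a H j ≢ b)
           (dc : DistinctlyColorable H v w) where

    v≢w-across : Condition2 H v w b ⊎ Condition3 H v w b → ¬ Condition1 H v w b →
      v i ≢ w j
    v≢w-across (inj₁ c2) _ vi≡wj =
      proj₂ (distinctlyColorable⇒separated dc ai aj≢b) (trans (sym (c2 i ai)) vi≡wj)
    v≢w-across (inj₂ c3) ¬c1 vi≡wj = ¬condition1⇒¬¬reversed c3 ¬c1 ai
      λ l al (_ , wl≡vi) →
        proj₂ (distinctlyColorable⇒separated dc al aj≢b) (trans wl≡vi vi≡wj)

    w≢v-across : Condition2 H v w b ⊎ Condition3 H v w b → ¬ Condition1 H v w b →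
      w i ≢ v j
    w≢v-across (inj₁ c2) _ wi≡vj =
      proj₁ (distinctlyColorable⇒separated dc ai aj≢b) (trans (c2 i ai) wi≡vj)
    w≢v-across (inj₂ c3) ¬c1 wi≡vj = ¬condition1⇒¬¬reversed c3 ¬c1 ai
      λ l al (vl≡wi , _) →
        proj₁ (distinctlyColorable⇒separated dc al aj≢b) (trans vl≡wi wi≡vj)

lemma3p1 : (H : SmallGraph) → Connected H → NoLeaves H →
    {n : ℕ} (G : SimpleGraph n) →
    (v w : HalfEdge (k H) → Fin n) →
    IsEdgeTuple G (k H) v → IsEdgeTuple G (k H) w →
    (b : Fin (t H)) (i j : HalfEdge (k H)) →
    a H i ≡ b → a H j ≢ b →
    DistinctlyColorable H v w →
    (Condition2 H v w b ⊎ Condition3 H v w b) →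
    ¬ Condition1 H v w b →
    (v i ≢ v j) × (v i ≢ w j) × (w i ≢ v j) × (w i ≢ w j)
lemma3p1 H _ _ G v w _ _ b i j ai aj≢b dc c2⊎c3 ¬c1 =
  proj₁ separated , v≢w-across H v w ai aj≢b dc c2⊎c3 ¬c1 ,
  w≢v-across H v w ai aj≢b dc c2⊎c3 ¬c1 , proj₂ separated
  where
  separated : (v i ≢ v j) × (w i ≢ w j)
  separated = distinctlyColorable⇒separated H v w dc ai aj≢b
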